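{- There is no connected mutation-finite graph with at least $8$ vertices that contains $\mathbf{X}_7$ as a (full) subgraph.
   Context: A graph here is a finite directed multigraph without loops and without oriented 2-cycles. For a vertex $k$ of such a graph $\Gamma$, the mutation $\mu_k\Gamma$ is obtained as follows: for every arrow $i\to k$ and every arrow $k\to j$ add a new arrow $i\to j$; then reverse every arrow starting or ending at $k$; finally remove pairs of opposite arrows (2-cycles) until none remain. $\Gamma$ is mutation-finite if only finitely many isomorphism classes of graphs are obtained from $\Gamma$ by sequences of mutations. A subgraph always means a full subgraph (containing all arrows between its vertices). $\mathbf{X}_7$: vertices $x,y_1,z_1,y_2,z_2,y_3,z_3$; for each $i=1,2,3$: one arrow $x\to y_i$, two arrows $y_i\to z_i$, one arrow $z_i\to x$. -}

module Defs where

open import Data.Nat using (ℕ; zero; suc; _+_; _*_; _∸_; _<_)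
open import Data.Fin using (Fin; toℕ; _≟_)
open import Data.Fin.Permutation using (Permutation′; _⟨$⟩ʳ_)
open import Data.List using (List)
open import Data.List.Membership.Propositional using (_∈_)
open import Data.Product using (Σ; ∃; _×_; _,_)
open import Data.Sum using (_⊎_)
open import Function.Definitions using (Injective)
open import Relation.Nullary using (yes; no)
open import Relation.Binary.PropositionalEquality using (_≡_)
open import Relation.Binary.Construct.Closure.ReflexiveTransitive using (Star)

-- A directed multigraph on the vertex set Fin n, given by arrow counts:
-- Arrows B i j = number of arrows i → j.
Arrows : ℕ → Set
Arrows n = Fin n → Fin n → ℕ

IsGraph : ∀ {n} → Arrows n → Set
IsGraph {n} B = (∀ i → B i i ≡ 0) × (∀ i j → B i j ≡ 0 ⊎ B j i ≡ 0)

-- For i, j ≠ k: after adding one arrow i → j for each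
-- pair of arrows i → k, k → j, there are B i j + B i k * B k j arrows i → j and
-- B j i + B j k * B k i arrows j → i; cancelling 2-cycles leaves the truncated
-- difference.
mutate : ∀ {n} → Fin n → Arrows n → Arrows n
mutate k B i j with i ≟ k | j ≟ k
... | yes _ | _     = B j i
... | no _  | yes _ = B j i
... | no _  | no _  = (B i j + B i k * B k j) ∸ (B j i + B j k * B k i)

data MutStep {n : ℕ} : Arrows n → Arrows n → Set where
  step : ∀ k B → MutStep B (mutate k B)

MutReachable : ∀ {n} → Arrows n → Arrows n → Set
MutReachable = Star MutStep

_≅_ : ∀ {n} → Arrows n → Arrows n → Set
_≅_ {n} B C = Σ (Permutation′ n) λ σ → ∀ i j → C (σ ⟨$⟩ʳ i) (σ ⟨$⟩ʳ j) ≡ B i j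

-- Mutation-finite: finitely many isomorphism classes among graphs
-- obtained by sequences of mutations, i.e. a finite list of representatives.
MutationFinite : ∀ {n} → Arrows n → Set
MutationFinite {n} B =
  Σ (List (Arrows n)) λ L → ∀ C → MutReachable B C → Σ (Arrows n) λ D → D ∈ L × C ≅ D

Adjacent : ∀ {n} → Arrows n → Fin n → Fin n → Set
Adjacent B i j = 0 < B i j ⊎ 0 < B j i

Connected : ∀ {n} → Arrows n → Set
Connected B = ∀ i j → Star (Adjacent B) i j

ContainsFull : ∀ {m n} → Arrows m → Arrows n → Set
ContainsFull {m} {n} S B =
  Σ (Fin m → Fin n) λ f → Injective _≡_ _≡_ f × (∀ a b → B (f a) (f b) ≡ S a b)

-- X₇ with vertices 0 = x, 1 = y₁, 2 = z₁, 3 = y₂, 4 = z₂, 5 = y₃, 6 = z₃.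
x7 : ℕ → ℕ → ℕ
x7 0 1 = 1
x7 0 3 = 1
x7 0 5 = 1
x7 1 2 = 2
x7 3 4 = 2
x7 5 6 = 2
x7 2 0 = 1
x7 4 0 = 1
x7 6 0 = 1
x7 _ _ = 0

X₇ : Arrows 7
X₇ a b = x7 (toℕ a) (toℕ b)

-- We prove that such a graph B is unbounded: its mutation class contains
-- graphs with arbitrarily many parallel arrows.  Isomorphism preserves arrow
-- multiplicities, so finitely many classes would bound them.
--
-- 1. Triangles.  A 3-cycle with weights 2 ≤ a ≤ b, c and max(b, c) ≥ 3 keeps
--    this shape and strictly gains weight when mutated at the vertex opposite
--    its lightest edge.  All other connected triangles with an edge of
--    multiplicity ≥ 3 reduce to it by a few explicit mutations.
-- 2. Full subgraphs.  Mutation commutes with restriction to a full subgraph,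
--    so an unbounded full subgraph makes the whole graph unbounded.
-- 3. Extensions of X₇.  By connectedness, some vertex v outside the copy of
--    X₇ is joined to it.  A certificate, a decision tree over the links of v
--    to vertices of X₇ checked by evaluation, shows that in every case a
--    short mutation sequence of the graph on v and a few vertices of X₇
--    produces a heavy triangle (links of ≥ 3 arrows are heavy already).

module Submission where

open import Defs
open import Data.Nat using (ℕ; zero; suc; _+_; _*_; _∸_; _≤_; _<_; z≤n; s≤s; _≤?_; _<?_)
open import Data.Nat.Properties hiding (_≟_)
open import Data.Nat.Properties using () renaming (_≟_ to _≟ℕ_)
open import Data.Nat.Tactic.RingSolver using (solve-∀)
open import Data.Fin using (Fin; _≟_; #_)
open import Data.Fin.Permutation using (_⟨$⟩ʳ_)
open import Data.Fin.Properties using (all?; any?; ¬∀⟶∃¬; injective⇒≤)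
open import Data.List using (List; []; _∷_)
open import Data.List.Membership.Propositional using (_∈_)
open import Data.List.Relation.Unary.Any using (here; there)
open import Data.Vec using (Vec; []; _∷_; lookup)
open import Data.Vec.Relation.Unary.All using (All; []; _∷_; lookupAny)
open import Data.Vec.Relation.Unary.All.Properties using (lookup⁺)
open import Data.Vec.Relation.Unary.Any as Any using (Any)
open import Data.Product using (Σ; ∃; _×_; _,_; proj₁; proj₂)
open import Data.Sum using (_⊎_; inj₁; inj₂; [_,_])
open import Data.Empty using (⊥-elim)
open import Function.Definitions using (Injective)
open import Relation.Nullary using (¬_; Dec; yes; no)
open import Relation.Nullary.Decidable using (¬?; _×-dec_; _⊎-dec_; map′; _→-dec_; from-yes)
open import Relation.Binary.PropositionalEquality hiding ([_])
open import Relation.Binary.Construct.Closure.ReflexiveTransitive using (Star; ε; _◅_; _◅◅_)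

module _ {n : ℕ} where

  Unbounded : Arrows n → Set
  Unbounded B = ∀ N → Σ (Arrows n) λ C → MutReachable B C ×
                      Σ (Fin n) λ p → Σ (Fin n) λ q → N ≤ C p q

  unbounded-back : ∀ {B C} → MutReachable B C → Unbounded C → Unbounded B
  unbounded-back B↝C unb N with unb N
  ... | D , C↝D , big = D , B↝C ◅◅ C↝D , big

  unbounded-mutate : ∀ {B} k → Unbounded (mutate k B) → Unbounded B
  unbounded-mutate {B} k = unbounded-back (step k B ◅ ε)

  -- Up to isomorphism, a finite list of graphs has bounded arrow
  -- multiplicities (by the largest total number of arrows in the list), so an
  -- unbounded graph is mutation-infinite.
  private
    sumFin : ∀ {m} → (Fin m → ℕ) → ℕ
    sumFin {zero}  _ = 0
    sumFin {suc m} g = g Fin.zero + sumFin (λ i → g (Fin.suc i))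

    ≤-sumFin : ∀ {m} (g : Fin m → ℕ) i → g i ≤ sumFin g
    ≤-sumFin g Fin.zero    = m≤m+n _ _
    ≤-sumFin g (Fin.suc i) = ≤-trans (≤-sumFin (λ i → g (Fin.suc i)) i) (m≤n+m _ _)

  arrowTotal : Arrows n → ℕ
  arrowTotal D = sumFin (λ i → sumFin (D i))

  ≤-arrowTotal : ∀ D i j → D i j ≤ arrowTotal D
  ≤-arrowTotal D i j = ≤-trans (≤-sumFin (D i) j) (≤-sumFin (λ i → sumFin (D i)) i)

  listTotal : List (Arrows n) → ℕ
  listTotal []      = 0
  listTotal (D ∷ L) = arrowTotal D + listTotal L

  ≤-listTotal : ∀ {D} L → D ∈ L → arrowTotal D ≤ listTotal L
  ≤-listTotal (D ∷ L) (here refl) = m≤m+n _ _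
  ≤-listTotal (D ∷ L) (there D∈L) = ≤-trans (≤-listTotal L D∈L) (m≤n+m _ _)

  unbounded⇒¬mutationFinite : ∀ {B} → Unbounded B → ¬ MutationFinite B
  unbounded⇒¬mutationFinite unb (L , classes) with unb (suc (listTotal L))
  ... | C , B↝C , p , q , big with classes C B↝C
  ... | D , D∈L , σ , C≅D =
    <-irrefl refl (≤-trans big (subst (_≤ listTotal L) (C≅D p q)
      (≤-trans (≤-arrowTotal D (σ ⟨$⟩ʳ p) (σ ⟨$⟩ʳ q)) (≤-listTotal L D∈L))))

module _ {n : ℕ} where

  mutate-from : ∀ k (B : Arrows n) j → mutate k B k j ≡ B j k
  mutate-from k B j with k ≟ k
  ... | yes _  = refl
  ... | no k≢k = ⊥-elim (k≢k refl)

  mutate-into : ∀ k (B : Arrows n) i → i ≢ k → mutate k B i k ≡ B k i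
  mutate-into k B i i≢k with i ≟ k | k ≟ k
  ... | yes i≡k | _      = ⊥-elim (i≢k i≡k)
  ... | no _    | yes _  = refl
  ... | no _    | no k≢k = ⊥-elim (k≢k refl)

  mutate-away : ∀ k (B : Arrows n) i j → i ≢ k → j ≢ k →
                mutate k B i j ≡ (B i j + B i k * B k j) ∸ (B j i + B j k * B k i)
  mutate-away k B i j i≢k j≢k with i ≟ k | j ≟ k
  ... | yes i≡k | _       = ⊥-elim (i≢k i≡k)
  ... | no _    | yes j≡k = ⊥-elim (j≢k j≡k)
  ... | no _    | no _    = refl

  mutate-away≡ : ∀ {k} {B : Arrows n} {i j} {w w′ x y x′ y′} → i ≢ k → j ≢ k →
                 B i j ≡ w → B j i ≡ w′ → B i k ≡ x → B k j ≡ y → B j k ≡ x′ → B k i ≡ y′ →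
                 mutate k B i j ≡ (w + x * y) ∸ (w′ + x′ * y′)
  mutate-away≡ {k} {B} {i} {j} i≢k j≢k eij eji eik ekj ejk eki =
    trans (mutate-away k B i j i≢k j≢k)
          (cong₂ _∸_ (cong₂ _+_ eij (cong₂ _*_ eik ekj)) (cong₂ _+_ eji (cong₂ _*_ ejk eki)))

  record Cycle (B : Arrows n) (i j k : Fin n) (a b c : ℕ) : Set where
    field
      i≢j : i ≢ j
      j≢k : j ≢ k
      i≢k : i ≢ k
      ij : B i j ≡ a
      jk : B j k ≡ b
      ki : B k i ≡ c
      ji : B j i ≡ 0
      kj : B k j ≡ 0
      ik : B i k ≡ 0

  rotate : ∀ {B i j k a b c} → Cycle B i j k a b c → Cycle B j k i b c a
  rotate C = record { i≢j = j≢k ; j≢k = ≢-sym i≢k ; i≢k = ≢-sym i≢j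
                    ; ij = jk ; jk = ki ; ki = ij ; ji = kj ; kj = ik ; ik = ji }
    where open Cycle C

  mutate-cycle : ∀ {B i j k a b c} → Cycle B i j k a b c → a ≤ b * c →
                 Cycle (mutate k B) j i k (b * c ∸ a) c b
  mutate-cycle {B} {i} {j} {k} {a} {b} {c} C a≤bc = record
    { i≢j = ≢-sym i≢j ; j≢k = i≢k ; i≢k = j≢k
    ; ij = new ; jk = trans (mutate-into k B i i≢k) ki ; ki = trans (mutate-from k B j) jk
    ; ji = cancelled ; kj = trans (mutate-from k B i) ik ; ik = trans (mutate-into k B j j≢k) kj }
    where
    open Cycle C
    new : mutate k B j i ≡ b * c ∸ a
    new = trans (mutate-away≡ j≢k i≢k ji ij jk ki ik kj) (cong (b * c ∸_) (+-identityʳ a))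
    cancelled : mutate k B i j ≡ 0
    cancelled = trans (mutate-away≡ i≢k j≢k ij ji ik kj jk ki)
                      (trans (cong (_∸ b * c) (+-identityʳ a)) (m≤n⇒m∸n≡0 a≤bc))

-- Arithmetic behind the growth of 3-cycles.  With 2 ≤ a ≤ b, a ≤ c and one of
-- b, c at least 3, the new weight b·c − a exceeds a and is at least b and c.
private
  thrice : ∀ a → 3 * a ≡ a + a + a
  thrice = solve-∀

  twice : ∀ a → 2 * a ≡ a + a
  twice = solve-∀

  twice<product : ∀ {a b c} → 2 ≤ a → a ≤ b → a ≤ c → 3 ≤ b ⊎ 3 ≤ c → a + a < b * c
  twice<product {a} {b} {c} 2≤a a≤b a≤c big = begin-strict
    a + a      <⟨ m<m+n (a + a) (≤-trans (s≤s z≤n) 2≤a) ⟩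
    a + a + a  ≡⟨ thrice a ⟨
    3 * a      ≤⟨ thrice≤product big ⟩
    b * c      ∎
    where
    open ≤-Reasoning
    thrice≤product : 3 ≤ b ⊎ 3 ≤ c → 3 * a ≤ b * c
    thrice≤product (inj₁ 3≤b) = *-mono-≤ 3≤b a≤c
    thrice≤product (inj₂ 3≤c) = subst (_≤ b * c) (*-comm a 3) (*-mono-≤ a≤b 3≤c)

  reverse-sum : ∀ a b c → a + b + c ≡ c + b + a
  reverse-sum = solve-∀

  sum≤product : ∀ {a d e p} → a ≤ d → 2 ≤ e → d * e ≡ p → d + a ≤ p
  sum≤product {a} {d} {e} a≤d 2≤e refl = begin
    d + a  ≤⟨ +-monoʳ-≤ d a≤d ⟩
    d + d  ≡⟨ twice d ⟨
    2 * d  ≤⟨ *-monoˡ-≤ d 2≤e ⟩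
    e * d  ≡⟨ *-comm e d ⟩
    d * e  ∎
    where open ≤-Reasoning

module _ {n : ℕ} where

  record Growing (B : Arrows n) : Set where
    field
      i j k : Fin n
      a b c : ℕ
      cycle : Cycle B i j k a b c
      2≤a   : 2 ≤ a
      a≤b   : a ≤ b
      a≤c   : a ≤ c
      big   : 3 ≤ b ⊎ 3 ≤ c

  weight : ∀ {B} → Growing B → ℕ
  weight P = Growing.a P + Growing.b P + Growing.c P

  -- Mutating at the vertex opposite the lightest edge yields again a growing
  -- cycle (its lightest edge being min(b, c)), of strictly larger total weight.
  grow : ∀ {B} (P : Growing B) →
         Σ (Growing (mutate (Growing.k P) B)) λ Q → weight P < weight Q
  grow P = pick (b ≤? c)
    where
    open Growing P
    x = b * c ∸ a
    2a<bc = twice<product 2≤a a≤b a≤c big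
    C′ = mutate-cycle cycle (≤-trans (m≤m+n a a) (<⇒≤ 2a<bc))
    a<x : a < x
    a<x = m+n≤o⇒m≤o∸n (suc a) 2a<bc
    3≤x : 3 ≤ x
    3≤x = ≤-trans (s≤s 2≤a) a<x
    pick : Dec (b ≤ c) → Σ (Growing (mutate k _)) λ Q → a + b + c < weight Q
    pick (yes b≤c) =
      record { cycle = rotate (rotate C′) ; 2≤a = ≤-trans 2≤a a≤b
             ; a≤b = b≤x ; a≤c = b≤c ; big = inj₁ 3≤x }
      , subst (_< b + x + c) (cong (_+ c) (+-comm b a)) (+-monoˡ-< c (+-monoʳ-< b a<x))
      where
      b≤x : b ≤ x
      b≤x = m+n≤o⇒m≤o∸n b (sum≤product a≤b (≤-trans 2≤a a≤c) refl)
    pick (no b≰c) =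
      record { cycle = rotate C′ ; 2≤a = ≤-trans 2≤a a≤c
             ; a≤b = c≤b ; a≤c = c≤x ; big = inj₂ 3≤x }
      , subst (_< c + b + x) (reverse-sum c b a) (+-monoʳ-< (c + b) a<x)
      where
      c≤b = <⇒≤ (≰⇒> b≰c)
      c≤x : c ≤ x
      c≤x = m+n≤o⇒m≤o∸n c (sum≤product a≤c (≤-trans 2≤a a≤b) (*-comm c b))

  iterate-grow : ∀ N {B} → Growing B →
                 Σ (Arrows n) λ C → MutReachable B C × Σ (Growing C) λ Q → N ≤ weight Q
  iterate-grow zero    {B} P = B , ε , P , z≤n
  iterate-grow (suc N) P with iterate-grow N P
  ... | C , B↝C , Q , N≤wQ with grow Q
  ... | Q′ , wQ<wQ′ =
    mutate (Growing.k Q) C , B↝C ◅◅ (step (Growing.k Q) C ◅ ε) , Q′ , ≤-<-trans N≤wQ wQ<wQ′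

  pigeonhole-sum : ∀ N a b c → 3 * N ≤ a + b + c → N ≤ a ⊎ N ≤ b ⊎ N ≤ c
  pigeonhole-sum N a b c 3N≤sum with N ≤? a | N ≤? b | N ≤? c
  ... | yes N≤a | _       | _       = inj₁ N≤a
  ... | no _    | yes N≤b | _       = inj₂ (inj₁ N≤b)
  ... | no _    | no _    | yes N≤c = inj₂ (inj₂ N≤c)
  ... | no N≰a  | no N≰b  | no N≰c  =
    ⊥-elim (<⇒≱ (+-mono-< (+-mono-< (≰⇒> N≰a) (≰⇒> N≰b)) (≰⇒> N≰c))
                (subst (_≤ a + b + c) (thrice N) 3N≤sum))

  growing⇒unbounded : ∀ {B} → Growing B → Unbounded B
  growing⇒unbounded P N with iterate-grow (3 * N) P
  ... | C , B↝C , Q , 3N≤wQ = C , B↝C , heavyEdge (pigeonhole-sum N a b c 3N≤wQ)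
    where
    open Growing Q
    open Cycle cycle
    heavyEdge : N ≤ a ⊎ N ≤ b ⊎ N ≤ c → Σ (Fin n) λ p → Σ (Fin n) λ q → N ≤ C p q
    heavyEdge (inj₁ N≤a)        = i , j , subst (N ≤_) (sym ij) N≤a
    heavyEdge (inj₂ (inj₁ N≤b)) = j , k , subst (N ≤_) (sym jk) N≤b
    heavyEdge (inj₂ (inj₂ N≤c)) = k , i , subst (N ≤_) (sym ki) N≤c

Heavy : ℕ → ℕ → ℕ → Set
Heavy a b c = 3 ≤ a ⊎ 3 ≤ b ⊎ 3 ≤ c

private
  rotate-heavy : ∀ {a b c} → Heavy a b c → Heavy b c a
  rotate-heavy (inj₁ 3≤a)        = inj₂ (inj₂ 3≤a)
  rotate-heavy (inj₂ (inj₁ 3≤b)) = inj₁ 3≤b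
  rotate-heavy (inj₂ (inj₂ 3≤c)) = inj₂ (inj₁ 3≤c)

  heavy-others : ∀ {a b c} → a ≤ b → Heavy a b c → 3 ≤ b ⊎ 3 ≤ c
  heavy-others a≤b (inj₁ 3≤a) = inj₁ (≤-trans 3≤a a≤b)
  heavy-others a≤b (inj₂ big) = big

  heavy-third : ∀ {c} → Heavy 1 1 c → 3 ≤ c
  heavy-third (inj₁ (s≤s ()))
  heavy-third (inj₂ (inj₁ (s≤s ())))
  heavy-third (inj₂ (inj₂ 3≤c)) = 3≤c

  2≤2+ : ∀ {m} → 2 ≤ suc (suc m)
  2≤2+ = s≤s (s≤s z≤n)

module _ {n : ℕ} where

  lightest-first : ∀ {B : Arrows n} {i j k a b c} → Cycle B i j k a b c →
                   2 ≤ a → a ≤ b → a ≤ c → Heavy a b c → Unbounded B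
  lightest-first C 2≤a a≤b a≤c big = growing⇒unbounded
    (record { cycle = C ; 2≤a = 2≤a ; a≤b = a≤b ; a≤c = a≤c ; big = heavy-others a≤b big })

  multiple-cycle⇒unbounded : ∀ {B : Arrows n} {i j k a b c} → Cycle B i j k a b c →
                             2 ≤ a → 2 ≤ b → 2 ≤ c → Heavy a b c → Unbounded B
  multiple-cycle⇒unbounded {a = a} {b} {c} C 2≤a 2≤b 2≤c big with a ≤? b | a ≤? c | b ≤? c
  ... | yes a≤b | yes a≤c | _ = lightest-first C 2≤a a≤b a≤c big
  ... | yes a≤b | no a≰c  | _ = lightest-first (rotate (rotate C)) 2≤c c≤a (≤-trans c≤a a≤b)
                                               (rotate-heavy (rotate-heavy big))
    where c≤a = <⇒≤ (≰⇒> a≰c)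
  ... | no a≰b  | _ | yes b≤c = lightest-first (rotate C) 2≤b b≤c (<⇒≤ (≰⇒> a≰b)) (rotate-heavy big)
  ... | no a≰b  | _ | no b≰c  = lightest-first (rotate (rotate C)) 2≤c (≤-trans c≤b b≤a) c≤b
                                               (rotate-heavy (rotate-heavy big))
    where b≤a = <⇒≤ (≰⇒> a≰b)
          c≤b = <⇒≤ (≰⇒> b≰c)

  -- A single arrow in a 3-cycle with two multiple edges: one mutation at the
  -- opposite vertex gives weights b·c − 1 ≥ 3, c, b.
  cycle-1bc⇒unbounded : ∀ {B : Arrows n} {i j k b c} → Cycle B i j k 1 b c → 2 ≤ b → 2 ≤ c → Unbounded B
  cycle-1bc⇒unbounded {k = k} {b} {c} C 2≤b 2≤c =
    unbounded-mutate k (multiple-cycle⇒unbounded (mutate-cycle C (≤-trans (s≤s z≤n) 4≤bc))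
                         (≤-trans (s≤s (s≤s z≤n)) 3≤bc-1) 2≤c 2≤b (inj₁ 3≤bc-1))
    where
    4≤bc : 4 ≤ b * c
    4≤bc = *-mono-≤ 2≤b 2≤c
    3≤bc-1 : 3 ≤ b * c ∸ 1
    3≤bc-1 = m+n≤o⇒m≤o∸n 3 (subst (_≤ b * c) (+-comm 1 3) 4≤bc)

  -- Two single arrows in a 3-cycle whose third edge is heavy: one mutation
  -- gives weights 1, c − 1 ≥ 2, c.
  cycle-11c⇒unbounded : ∀ {B : Arrows n} {i j k c} → Cycle B i j k 1 1 c → 3 ≤ c → Unbounded B
  cycle-11c⇒unbounded {k = k} {c} C 3≤c =
    unbounded-mutate k (cycle-1bc⇒unbounded (rotate (rotate (mutate-cycle C 1≤1c)))
                         (m+n≤o⇒m≤o∸n 2 (subst (3 ≤_) (sym (*-identityˡ c)) 3≤c))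
                         (≤-trans (s≤s (s≤s z≤n)) 3≤c))
    where
    1≤1c : 1 ≤ 1 * c
    1≤1c = subst (1 ≤_) (sym (*-identityˡ c)) (≤-trans (s≤s z≤n) 3≤c)

  cycle⇒unbounded : ∀ {B : Arrows n} {i j k a b c} → Cycle B i j k a b c →
                    1 ≤ a → 1 ≤ b → 1 ≤ c → Heavy a b c → Unbounded B
  cycle⇒unbounded {a = 1}           {1}           {c}           C _ _ _ big =
    cycle-11c⇒unbounded C (heavy-third big)
  cycle⇒unbounded {a = 1}           {suc (suc _)} {1}           C _ _ _ big =
    cycle-11c⇒unbounded (rotate (rotate C)) (heavy-third (rotate-heavy (rotate-heavy big)))
  cycle⇒unbounded {a = suc (suc _)} {1}           {1}           C _ _ _ big =
    cycle-11c⇒unbounded (rotate C) (heavy-third (rotate-heavy big))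
  cycle⇒unbounded {a = 1}           {suc (suc _)} {suc (suc _)} C _ _ _ _   =
    cycle-1bc⇒unbounded C 2≤2+ 2≤2+
  cycle⇒unbounded {a = suc (suc _)} {1}           {suc (suc _)} C _ _ _ _   =
    cycle-1bc⇒unbounded (rotate C) 2≤2+ 2≤2+
  cycle⇒unbounded {a = suc (suc _)} {suc (suc _)} {1}           C _ _ _ _   =
    cycle-1bc⇒unbounded (rotate (rotate C)) 2≤2+ 2≤2+
  cycle⇒unbounded {a = suc (suc _)} {suc (suc _)} {suc (suc _)} C _ _ _ big =
    multiple-cycle⇒unbounded C 2≤2+ 2≤2+ 2≤2+ big

  record Transitive (B : Arrows n) (i j k : Fin n) (α β γ : ℕ) : Set where
    field
      i≢j : i ≢ j
      j≢k : j ≢ k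
      i≢k : i ≢ k
      ij : B i j ≡ α
      jk : B j k ≡ β
      ik : B i k ≡ γ
      ji : B j i ≡ 0
      kj : B k j ≡ 0
      ki : B k i ≡ 0

  -- Mutating at the middle vertex j turns it into the 3-cycle
  -- i → k → j → i with weights γ + α·β, β, α.
  transitive⇒unbounded : ∀ {B : Arrows n} {i j k α β γ} → Transitive B i j k α β γ →
                         1 ≤ α → 1 ≤ β → 3 ≤ γ + α * β → Unbounded B
  transitive⇒unbounded {B} {i} {j} {k} {α} {β} {γ} T 1≤α 1≤β 3≤w =
    unbounded-mutate j (cycle⇒unbounded C (≤-trans (s≤s z≤n) 3≤w) 1≤β 1≤α (inj₁ 3≤w))
    where
    open Transitive T
    C : Cycle (mutate j B) i k j (γ + α * β) β α
    C = record
      { i≢j = i≢k ; j≢k = ≢-sym j≢k ; i≢k = i≢j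
      ; ij = mutate-away≡ i≢j (≢-sym j≢k) ik ki ij jk kj ji
      ; jk = trans (mutate-into j B k (≢-sym j≢k)) jk
      ; ki = trans (mutate-from j B i) ij
      ; ji = trans (mutate-away≡ (≢-sym j≢k) i≢j ki ik kj ji ij jk) (0∸n≡0 (γ + α * β))
      ; kj = trans (mutate-from j B k) kj
      ; ik = trans (mutate-into j B i i≢j) ji }

  mutate-keeps : ∀ {B : Arrows n} {i j k} → i ≢ k → j ≢ k →
                 B i k * B k j ≡ 0 → B j k * B k i ≡ 0 → B j i ≡ 0 →
                 mutate k B i j ≡ B i j × mutate k B j i ≡ 0
  mutate-keeps {B} {i} {j} {k} i≢k j≢k ikj jki ji =
    trans (mutate-away k B i j i≢k j≢k)
          (trans (cong₂ _∸_ (cong (B i j +_) ikj) (cong₂ _+_ ji jki)) (+-identityʳ (B i j)))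
    , trans (mutate-away k B j i j≢k i≢k)
            (trans (cong (_∸ (B i j + B i k * B k j)) (cong₂ _+_ ji jki)) (0∸n≡0 (B i j + B i k * B k j)))

  NoTwoCycle : Arrows n → Fin n → Fin n → Set
  NoTwoCycle B i k = B i k ≡ 0 ⊎ B k i ≡ 0

  data Edge (B : Arrows n) (i k : Fin n) : Set where
    absent   : B i k ≡ 0 → B k i ≡ 0 → Edge B i k
    forward  : ∀ r → B i k ≡ suc r → B k i ≡ 0 → Edge B i k
    backward : ∀ r → B i k ≡ 0 → B k i ≡ suc r → Edge B i k

  edge : ∀ {B : Arrows n} {i k} → NoTwoCycle B i k → Edge B i k
  edge {B} {i} {k} (inj₁ ik) with B k i in ki
  ... | zero  = absent ik ki
  ... | suc r = backward r ik ki
  edge {B} {i} {k} (inj₂ ki) with B i k in ik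
  ... | zero  = absent ik ki
  ... | suc r = forward r ik ki

  record HeavyTriple (B : Arrows n) (i j k : Fin n) : Set where
    constructor heavyTriple
    field
      i≢j    : i ≢ j
      j≢k    : j ≢ k
      i≢k    : i ≢ k
      heavy  : 3 ≤ B i j
      ji     : B j i ≡ 0
      ik?    : NoTwoCycle B i k
      jk?    : NoTwoCycle B j k
      joined : Adjacent B i k ⊎ Adjacent B j k

  -- Depending on
  -- the edges at k it is a 3-cycle or an acyclic triangle, or it becomes one
  -- after mutating at k when k is a source or sink joined to only one of i, j.
  module HeavyTriangle {B : Arrows n} {i j k} (H : HeavyTriple B i j k) where
    open HeavyTriple H

    private
      p = B i j
      1≤p = ≤-trans (s≤s z≤n) heavy
      k≢i = ≢-sym i≢k
      k≢j = ≢-sym j≢k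
      reversed : ∀ {l c} → l ≢ k → B k l ≡ c → mutate k B l k ≡ c
      reversed l≢k kl = trans (mutate-into k B _ l≢k) kl

    -- k a sink joined only to j: mutating at k gives the path i → j → k.
    sink-at-k : ∀ {q} → B i k ≡ 0 → B k i ≡ 0 → B j k ≡ 0 → B k j ≡ suc q → Unbounded B
    sink-at-k {q} ik ki jk kj =
      unbounded-mutate k (transitive⇒unbounded {α = p} {suc q} {0}
        (record { i≢j = i≢j ; j≢k = j≢k ; i≢k = i≢k ; ij = proj₁ keep ; jk = reversed j≢k kj
                ; ik = reversed i≢k ki ; ji = proj₂ keep ; kj = trans (mutate-from k B j) jk
                ; ki = trans (mutate-from k B i) ik })
        1≤p (s≤s z≤n) (≤-trans heavy (m≤m*n p (suc q))))
      where keep = mutate-keeps i≢k j≢k (cong (_* B k j) ik) (cong (_* B k i) jk) ji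

    -- k a source joined only to i: mutating at k gives the path k → i → j.
    source-at-k : ∀ {r} → B i k ≡ suc r → B k i ≡ 0 → B j k ≡ 0 → B k j ≡ 0 → Unbounded B
    source-at-k {r} ik ki jk kj =
      unbounded-mutate k (transitive⇒unbounded {α = suc r} {p} {0}
        (record { i≢j = k≢i ; j≢k = i≢j ; i≢k = k≢j ; ij = trans (mutate-from k B i) ik
                ; jk = proj₁ keep ; ik = trans (mutate-from k B j) jk ; ji = reversed i≢k ki
                ; kj = proj₂ keep ; ki = reversed j≢k kj })
        (s≤s z≤n) 1≤p (≤-trans heavy (m≤n*m p (suc r))))
      where keep = mutate-keeps i≢k j≢k (trans (cong (B i k *_) kj) (*-zeroʳ (B i k)))
                                (cong (_* B k i) jk) ji

    not-adjacent : ∀ {l} → B l k ≡ 0 → B k l ≡ 0 → ¬ Adjacent B l k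
    not-adjacent lk kl (inj₁ 0<lk) = <-irrefl (sym lk) 0<lk
    not-adjacent lk kl (inj₂ 0<kl) = <-irrefl (sym kl) 0<kl

    by-edges : Edge B i k → Edge B j k → Unbounded B
    by-edges (absent ik ki) (absent jk kj) =
      ⊥-elim ([ not-adjacent ik ki , not-adjacent jk kj ] joined)
    by-edges (absent ik ki) (backward q jk kj) = sink-at-k ik ki jk kj
    by-edges (forward r ik ki) (absent jk kj) = source-at-k ik ki jk kj
    by-edges (absent ik ki) (forward q jk kj) =
      transitive⇒unbounded {α = p} {suc q} {0}
        (record { i≢j = i≢j ; j≢k = j≢k ; i≢k = i≢k ; ij = refl ; jk = jk ; ik = ik
                ; ji = ji ; kj = kj ; ki = ki })
        1≤p (s≤s z≤n) (≤-trans heavy (m≤m*n p (suc q)))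
    by-edges (backward r ik ki) (absent jk kj) =
      transitive⇒unbounded {α = suc r} {p} {0}
        (record { i≢j = k≢i ; j≢k = i≢j ; i≢k = k≢j ; ij = ki ; jk = refl ; ik = kj
                ; ji = ik ; kj = ji ; ki = jk })
        (s≤s z≤n) 1≤p (≤-trans heavy (m≤n*m p (suc r)))
    by-edges (forward r ik ki) (forward q jk kj) =
      transitive⇒unbounded {α = p} {suc q} {suc r}
        (record { i≢j = i≢j ; j≢k = j≢k ; i≢k = i≢k ; ij = refl ; jk = jk ; ik = ik
                ; ji = ji ; kj = kj ; ki = ki })
        1≤p (s≤s z≤n) (≤-trans heavy (≤-trans (m≤m*n p (suc q)) (m≤n+m _ (suc r))))
    by-edges (forward r ik ki) (backward q jk kj) =
      transitive⇒unbounded {α = suc r} {suc q} {p}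
        (record { i≢j = i≢k ; j≢k = k≢j ; i≢k = i≢j ; ij = ik ; jk = kj ; ik = refl
                ; ji = ki ; kj = jk ; ki = ji })
        (s≤s z≤n) (s≤s z≤n) (≤-trans heavy (m≤m+n p _))
    by-edges (backward r ik ki) (backward q jk kj) =
      transitive⇒unbounded {α = suc r} {p} {suc q}
        (record { i≢j = k≢i ; j≢k = i≢j ; i≢k = k≢j ; ij = ki ; jk = refl ; ik = kj
                ; ji = ik ; kj = ji ; ki = jk })
        (s≤s z≤n) 1≤p (≤-trans heavy (≤-trans (m≤n*m p (suc r)) (m≤n+m _ (suc q))))
    by-edges (backward r ik ki) (forward q jk kj) =
      cycle⇒unbounded {a = p} {suc q} {suc r}
        (record { i≢j = i≢j ; j≢k = j≢k ; i≢k = i≢k ; ij = refl ; jk = jk ; ki = ki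
                ; ji = ji ; kj = kj ; ik = ik })
        1≤p (s≤s z≤n) (s≤s z≤n) (inj₁ heavy)

  heavyTriple⇒unbounded : ∀ {B : Arrows n} {i j k} → HeavyTriple B i j k → Unbounded B
  heavyTriple⇒unbounded H = by-edges (edge ik?) (edge jk?)
    where open HeavyTriangle H
          open HeavyTriple H

module _ {m n : ℕ} where

  Embeds : (Fin m → Fin n) → Arrows m → Arrows n → Set
  Embeds g S B = ∀ a b → B (g a) (g b) ≡ S a b

  module _ {g : Fin m → Fin n} (g-inj : Injective _≡_ _≡_ g) where

    embeds-mutate : ∀ {S B} k → Embeds g S B → Embeds g (mutate k S) (mutate (g k) B)
    embeds-mutate {S} {B} k E a b = entry (a ≟ k) (b ≟ k)
      where
      entry : Dec (a ≡ k) → Dec (b ≡ k) → mutate (g k) B (g a) (g b) ≡ mutate k S a b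
      entry (yes refl) _          = trans (mutate-from (g k) B (g b)) (trans (E b k) (sym (mutate-from k S b)))
      entry (no a≢k)   (yes refl) = trans (mutate-into (g k) B (g a) (λ e → a≢k (g-inj e)))
                                          (trans (E k a) (sym (mutate-into k S a a≢k)))
      entry (no a≢k)   (no b≢k)   =
        trans (mutate-away≡ (λ e → a≢k (g-inj e)) (λ e → b≢k (g-inj e))
                            (E a b) (E b a) (E a k) (E k b) (E b k) (E k a))
              (sym (mutate-away k S a b a≢k b≢k))

    embeds-reachable : ∀ {S S′ B} → Embeds g S B → MutReachable S S′ →
                       Σ (Arrows n) λ C → MutReachable B C × Embeds g S′ C
    embeds-reachable {B = B} E ε = B , ε , E
    embeds-reachable {B = B} E (step k S ◅ S↝S′) with embeds-reachable (embeds-mutate k E) S↝S′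
    ... | C , B↝C , E′ = C , step (g k) B ◅ B↝C , E′

    unbounded-subgraph : ∀ {S B} → Embeds g S B → Unbounded S → Unbounded B
    unbounded-subgraph E unb N with unb N
    ... | S′ , S↝S′ , p , q , N≤S′pq with embeds-reachable E S↝S′
    ... | C , B↝C , E′ = C , B↝C , g p , g q , subst (N ≤_) (sym (E′ p q)) N≤S′pq

mutateSeq : ∀ {m} → List (Fin m) → Arrows m → Arrows m
mutateSeq []       S = S
mutateSeq (k ∷ ks) S = mutateSeq ks (mutate k S)

reachable-mutateSeq : ∀ {m} ks (S : Arrows m) → MutReachable S (mutateSeq ks S)
reachable-mutateSeq []       S = ε
reachable-mutateSeq (k ∷ ks) S = step k S ◅ reachable-mutateSeq ks (mutate k S)

module _ {n : ℕ} where

  noTwoCycle? : ∀ (B : Arrows n) i k → Dec (NoTwoCycle B i k)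
  noTwoCycle? B i k = (B i k ≟ℕ 0) ⊎-dec (B k i ≟ℕ 0)

  adjacent? : ∀ (B : Arrows n) i k → Dec (Adjacent B i k)
  adjacent? B i k = (0 <? B i k) ⊎-dec (0 <? B k i)

  heavyTriple? : ∀ (B : Arrows n) i j k → Dec (HeavyTriple B i j k)
  heavyTriple? B i j k =
    map′ (λ (i≢j , j≢k , i≢k , heavy , ji , ik? , jk? , joined) →
            heavyTriple i≢j j≢k i≢k heavy ji ik? jk? joined)
         (λ (heavyTriple i≢j j≢k i≢k heavy ji ik? jk? joined) →
            i≢j , j≢k , i≢k , heavy , ji , ik? , jk? , joined)
         (¬? (i ≟ j) ×-dec ¬? (j ≟ k) ×-dec ¬? (i ≟ k) ×-dec (3 ≤? B i j) ×-dec (B j i ≟ℕ 0) ×-dec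
          noTwoCycle? B i k ×-dec noTwoCycle? B j k ×-dec (adjacent? B i k ⊎-dec adjacent? B j k))

-- How a vertex u of X₇ can be joined to an extra vertex v by at most two
-- arrows: outₘ means m arrows v → u, inₘ means m arrows u → v.
data Link : Set where
  none out₁ out₂ in₁ in₂ : Link

outArrows : Link → ℕ
outArrows out₁ = 1
outArrows out₂ = 2
outArrows _    = 0

inArrows : Link → ℕ
inArrows in₁ = 1
inArrows in₂ = 2
inArrows _   = 0

isNone? : ∀ l → Dec (l ≡ none)
isNone? none = yes refl
isNone? out₁ = no λ ()
isNone? out₂ = no λ ()
isNone? in₁  = no λ ()
isNone? in₂  = no λ ()

cases : ∀ {A : Set} → A → A → A → A → A → Link → A
cases a _ _ _ _ none = a
cases _ a _ _ _ out₁ = a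
cases _ _ a _ _ out₂ = a
cases _ _ _ a _ in₁  = a
cases _ _ _ _ a in₂  = a

all-links? : ∀ {P : Link → Set} → (∀ l → Dec (P l)) → Dec (∀ l → P l)
all-links? P? =
  map′ (λ (p₀ , p₁ , p₂ , p₃ , p₄) → cases′ p₀ p₁ p₂ p₃ p₄)
       (λ h → h none , h out₁ , h out₂ , h in₁ , h in₂)
       (P? none ×-dec P? out₁ ×-dec P? out₂ ×-dec P? in₁ ×-dec P? in₂)
  where
  cases′ : ∀ {P : Link → Set} → P none → P out₁ → P out₂ → P in₁ → P in₂ → ∀ l → P l
  cases′ p₀ _ _ _ _ none = p₀
  cases′ _ p₁ _ _ _ out₁ = p₁
  cases′ _ _ p₂ _ _ out₂ = p₂
  cases′ _ _ _ p₃ _ in₁  = p₃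
  cases′ _ _ _ _ p₄ in₂  = p₄

-- Observations: the links of v to some vertices of X₇, most recent first.
Observation : ℕ → Set
Observation d = Vec (Fin 7 × Link) d

vertexAt : ∀ {d} → Observation d → Fin d → Fin 7
vertexAt obs a = proj₁ (lookup obs a)

linkAt : ∀ {d} → Observation d → Fin d → Link
linkAt obs a = proj₂ (lookup obs a)

-- The graph spanned by v and the observed vertices of X₇: vertex 0 is v and
-- vertex a + 1 is the a-th observed vertex.
localGraph : ∀ {d} → Observation d → Arrows (suc d)
localGraph obs Fin.zero    Fin.zero    = 0
localGraph obs Fin.zero    (Fin.suc b) = outArrows (linkAt obs b)
localGraph obs (Fin.suc a) Fin.zero    = inArrows (linkAt obs a)
localGraph obs (Fin.suc a) (Fin.suc b) = X₇ (vertexAt obs a) (vertexAt obs b)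

Distinct : ∀ {d} → Observation d → Set
Distinct obs = ∀ a b → vertexAt obs a ≡ vertexAt obs b → a ≡ b

distinct? : ∀ {d} (obs : Observation d) → Dec (Distinct obs)
distinct? obs = all? λ a → all? λ b → (vertexAt obs a ≟ vertexAt obs b) →-dec (a ≟ b)

-- A certificate that every extension of X₇ by a joined vertex v is
-- unbounded: a decision tree that splits on the link of v to a vertex of X₇
-- and ends either in a heavy triple reached by mutating the local graph along
-- a list of its vertices, or in the observation that v is joined to nothing.
data Certificate (d : ℕ) : Set where
  split       : Fin 7 → (Link → Certificate (suc d)) → Certificate d
  heavy-after : List (Fin (suc d)) → (i j k : Fin (suc d)) → Certificate d
  isolated    : Certificate d

Isolated : ∀ {d} → Observation d → Set
Isolated obs = ∀ a → Any (λ e → proj₁ e ≡ a × proj₂ e ≡ none) obs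

Valid : ∀ {d} → Observation d → Certificate d → Set
Valid obs (split u next)          = ∀ l → Valid ((u , l) ∷ obs) (next l)
Valid obs (heavy-after ks i j k) = Distinct obs × HeavyTriple (mutateSeq ks (localGraph obs)) i j k
Valid obs isolated                = Isolated obs

-- Validity is decidable, so a concrete certificate is checked by evaluation.
valid? : ∀ {d} (obs : Observation d) c → Dec (Valid obs c)
valid? obs (split u next)         = all-links? λ l → valid? ((u , l) ∷ obs) (next l)
valid? obs (heavy-after ks i j k) = distinct? obs ×-dec heavyTriple? (mutateSeq ks (localGraph obs)) i j k
valid? obs isolated               =
  all? λ a → Any.any? (λ e → (proj₁ e ≟ a) ×-dec isNone? (proj₂ e)) obs

neighbour : Fin 7 → Fin 7
neighbour Fin.zero    = # 1
neighbour (Fin.suc _) = # 0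

neighbour-adjacent : ∀ u → Adjacent X₇ u (neighbour u)
neighbour-adjacent = from-yes (all? λ u → adjacent? X₇ u (neighbour u))

neighbour-distinct : ∀ u → u ≢ neighbour u
neighbour-distinct = from-yes (all? λ u → ¬? (u ≟ neighbour u))

module Extension {n : ℕ} (B : Arrows n) (isGraph : IsGraph B)
                 (f : Fin 7 → Fin n) (f-inj : Injective _≡_ _≡_ f)
                 (f-full : ∀ a b → B (f a) (f b) ≡ X₇ a b)
                 (v : Fin n) (v∉f : ∀ a → f a ≢ v) (a₀ : Fin 7) (v~fa₀ : Adjacent B (f a₀) v) where

  Realised : Fin 7 × Link → Set
  Realised (u , l) = B v (f u) ≡ outArrows l × B (f u) v ≡ inArrows l

  adjacent-image : ∀ {u w} → Adjacent X₇ u w → Adjacent B (f u) (f w)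
  adjacent-image {u} {w} (inj₁ 0<uw) = inj₁ (subst (0 <_) (sym (f-full u w)) 0<uw)
  adjacent-image {u} {w} (inj₂ 0<wu) = inj₂ (subst (0 <_) (sym (f-full w u)) 0<wu)

  -- Either v and f u are joined by at most two arrows, recorded by a link,
  -- or by at least three, and then v, f u and f (neighbour u) form a heavy
  -- triple.
  classify : ∀ u → Unbounded B ⊎ Σ Link λ l → Realised (u , l)
  classify u = by-counts (B v (f u)) (B (f u) v) refl refl
    where
    w = neighbour u
    fu≢fw : f u ≢ f w
    fu≢fw e = neighbour-distinct u (f-inj e)
    fw~fu : Adjacent B (f u) (f w)
    fw~fu = adjacent-image (neighbour-adjacent u)
    by-counts : ∀ p q → B v (f u) ≡ p → B (f u) v ≡ q → Unbounded B ⊎ Σ Link λ l → Realised (u , l)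
    by-counts 0 0 vu uv = inj₂ (none , vu , uv)
    by-counts 0 1 vu uv = inj₂ (in₁ , vu , uv)
    by-counts 0 2 vu uv = inj₂ (in₂ , vu , uv)
    by-counts 1 0 vu uv = inj₂ (out₁ , vu , uv)
    by-counts 2 0 vu uv = inj₂ (out₂ , vu , uv)
    by-counts (suc (suc (suc p))) 0 vu uv = inj₁ (heavyTriple⇒unbounded
      (heavyTriple (λ e → v∉f u (sym e)) fu≢fw (λ e → v∉f w (sym e))
                   (subst (3 ≤_) (sym vu) (s≤s (s≤s (s≤s z≤n)))) uv
                   (proj₂ isGraph v (f w)) (proj₂ isGraph (f u) (f w)) (inj₂ fw~fu)))
    by-counts 0 (suc (suc (suc q))) vu uv = inj₁ (heavyTriple⇒unbounded
      (heavyTriple (v∉f u) (λ e → v∉f w (sym e)) fu≢fw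
                   (subst (3 ≤_) (sym uv) (s≤s (s≤s (s≤s z≤n)))) vu
                   (proj₂ isGraph (f u) (f w)) (proj₂ isGraph v (f w)) (inj₁ fw~fu)))
    by-counts (suc p) (suc q) vu uv with proj₂ isGraph v (f u)
    ... | inj₁ vu≡0 = ⊥-elim (0≢1+n (trans (sym vu≡0) vu))
    ... | inj₂ uv≡0 = ⊥-elim (0≢1+n (trans (sym uv≡0) uv))

  embed : ∀ {d} → Observation d → Fin (suc d) → Fin n
  embed obs Fin.zero    = v
  embed obs (Fin.suc a) = f (vertexAt obs a)

  embed-injective : ∀ {d} (obs : Observation d) → Distinct obs → Injective _≡_ _≡_ (embed obs)
  embed-injective obs dist {Fin.zero}  {Fin.zero}  _ = refl
  embed-injective obs dist {Fin.zero}  {Fin.suc b} e = ⊥-elim (v∉f _ (sym e))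
  embed-injective obs dist {Fin.suc a} {Fin.zero}  e = ⊥-elim (v∉f _ e)
  embed-injective obs dist {Fin.suc a} {Fin.suc b} e = cong Fin.suc (dist a b (f-inj e))

  embeds-local : ∀ {d} (obs : Observation d) → All Realised obs →
                 Embeds (embed obs) (localGraph obs) B
  embeds-local obs real Fin.zero    Fin.zero    = proj₁ isGraph v
  embeds-local obs real Fin.zero    (Fin.suc b) = proj₁ (lookup⁺ real b)
  embeds-local obs real (Fin.suc a) Fin.zero    = proj₂ (lookup⁺ real a)
  embeds-local obs real (Fin.suc a) (Fin.suc b) = f-full _ _

  sound : ∀ {d} (obs : Observation d) → All Realised obs → (c : Certificate d) → Valid obs c → Unbounded B
  sound obs real (split u next) valid with classify u
  ... | inj₁ unbounded = unbounded
  ... | inj₂ (l , r)   = sound ((u , l) ∷ obs) (r ∷ real) (next l) (valid l)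
  sound obs real (heavy-after ks i j k) (dist , heavy) =
    unbounded-subgraph (embed-injective obs dist) (embeds-local obs real)
      (unbounded-back (reachable-mutateSeq ks (localGraph obs)) (heavyTriple⇒unbounded heavy))
  sound obs real isolated iso = ⊥-elim (silent (lookupAny real (iso a₀)) v~fa₀)
    where
    silent : ∀ {e} → Realised e × (proj₁ e ≡ a₀ × proj₂ e ≡ none) → ¬ Adjacent B (f a₀) v
    silent ((vu , uv) , refl , refl) (inj₁ 0<uv) = <-irrefl (sym uv) 0<uv
    silent ((vu , uv) , refl , refl) (inj₂ 0<vu) = <-irrefl (sym vu) 0<vu

x7-certificate : Certificate 0
x7-certificate =
  split (# 1) (cases
    (split (# 2) (cases
      (split (# 0) (cases
        (split (# 3) (cases
          (split (# 4) (cases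
            (split (# 5) (cases
              (split (# 6) (cases
                (isolated)
                (heavy-after (# 0 ∷ # 1 ∷ # 2 ∷ []) (# 1) (# 0) (# 2))
                (heavy-after (# 0 ∷ # 1 ∷ []) (# 2) (# 0) (# 1))
                (heavy-after (# 1 ∷ # 2 ∷ []) (# 1) (# 0) (# 2))
                (heavy-after (# 1 ∷ []) (# 2) (# 0) (# 1))))
              (heavy-after (# 0 ∷ # 4 ∷ # 2 ∷ # 3 ∷ # 1 ∷ # 5 ∷ []) (# 1) (# 0) (# 3))
              (heavy-after (# 0 ∷ # 1 ∷ # 0 ∷ []) (# 4) (# 1) (# 0))
              (heavy-after (# 4 ∷ # 2 ∷ # 3 ∷ # 1 ∷ # 5 ∷ []) (# 1) (# 0) (# 3))
              (heavy-after (# 1 ∷ # 0 ∷ []) (# 4) (# 1) (# 0))))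
            (heavy-after (# 0 ∷ # 1 ∷ # 2 ∷ []) (# 1) (# 0) (# 2))
            (heavy-after (# 0 ∷ # 1 ∷ []) (# 2) (# 0) (# 1))
            (heavy-after (# 1 ∷ # 2 ∷ []) (# 1) (# 0) (# 2))
            (heavy-after (# 1 ∷ []) (# 2) (# 0) (# 1))))
          (split (# 6) (cases
            (heavy-after (# 0 ∷ # 3 ∷ # 4 ∷ # 5 ∷ # 2 ∷ # 1 ∷ []) (# 2) (# 0) (# 1))
            (heavy-after (# 1 ∷ # 3 ∷ # 4 ∷ # 5 ∷ []) (# 0) (# 2) (# 1))
            (heavy-after (# 1 ∷ # 0 ∷ []) (# 1) (# 3) (# 0))
            (heavy-after (# 0 ∷ # 3 ∷ # 4 ∷ # 5 ∷ []) (# 1) (# 2) (# 0))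
            (heavy-after (# 0 ∷ # 1 ∷ []) (# 0) (# 2) (# 1))))
          (heavy-after (# 0 ∷ # 1 ∷ # 0 ∷ []) (# 2) (# 1) (# 0))
          (split (# 4) (cases
            (heavy-after (# 0 ∷ # 2 ∷ # 1 ∷ []) (# 0) (# 2) (# 1))
            (heavy-after (# 0 ∷ []) (# 2) (# 1) (# 0))
            (heavy-after (# 0 ∷ []) (# 2) (# 1) (# 0))
            (heavy-after (# 1 ∷ []) (# 2) (# 0) (# 1))
            (heavy-after (# 1 ∷ []) (# 2) (# 0) (# 1))))
          (heavy-after (# 1 ∷ # 0 ∷ []) (# 2) (# 1) (# 0))))
        (split (# 4) (cases
          (split (# 6) (cases
            (heavy-after (# 3 ∷ # 0 ∷ # 1 ∷ # 2 ∷ # 5 ∷ []) (# 3) (# 4) (# 0))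
            (heavy-after (# 1 ∷ # 3 ∷ # 0 ∷ []) (# 3) (# 5) (# 0))
            (heavy-after (# 1 ∷ []) (# 0) (# 3) (# 1))
            (heavy-after (# 0 ∷ # 3 ∷ # 1 ∷ []) (# 3) (# 5) (# 0))
            (heavy-after (# 0 ∷ []) (# 1) (# 3) (# 0))))
          (heavy-after (# 1 ∷ # 2 ∷ # 0 ∷ []) (# 2) (# 4) (# 0))
          (heavy-after (# 1 ∷ []) (# 0) (# 2) (# 1))
          (heavy-after (# 0 ∷ # 2 ∷ # 1 ∷ []) (# 2) (# 4) (# 0))
          (heavy-after (# 0 ∷ []) (# 1) (# 2) (# 0))))
        (heavy-after (# 1 ∷ # 0 ∷ []) (# 1) (# 3) (# 0))
        (split (# 3) (cases
          (split (# 5) (cases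
            (heavy-after (# 3 ∷ # 0 ∷ # 1 ∷ # 2 ∷ # 4 ∷ []) (# 5) (# 3) (# 0))
            (heavy-after (# 0 ∷ # 3 ∷ # 1 ∷ []) (# 4) (# 3) (# 0))
            (heavy-after (# 0 ∷ []) (# 3) (# 1) (# 0))
            (heavy-after (# 1 ∷ # 3 ∷ # 0 ∷ []) (# 4) (# 3) (# 0))
            (heavy-after (# 1 ∷ []) (# 3) (# 0) (# 1))))
          (heavy-after (# 0 ∷ # 2 ∷ # 1 ∷ []) (# 3) (# 2) (# 0))
          (heavy-after (# 0 ∷ []) (# 2) (# 1) (# 0))
          (heavy-after (# 1 ∷ # 2 ∷ # 0 ∷ []) (# 3) (# 2) (# 0))
          (heavy-after (# 1 ∷ []) (# 2) (# 0) (# 1))))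
        (heavy-after (# 1 ∷ # 0 ∷ []) (# 2) (# 1) (# 0))))
      (heavy-after (# 0 ∷ # 1 ∷ # 2 ∷ []) (# 1) (# 0) (# 2))
      (heavy-after (# 0 ∷ # 1 ∷ []) (# 2) (# 0) (# 1))
      (heavy-after (# 1 ∷ # 2 ∷ []) (# 1) (# 0) (# 2))
      (heavy-after (# 1 ∷ []) (# 2) (# 0) (# 1))))
    (split (# 3) (cases
      (split (# 0) (cases
        (split (# 4) (cases
          (split (# 6) (cases
            (heavy-after (# 0 ∷ # 3 ∷ # 2 ∷ # 4 ∷ # 5 ∷ # 1 ∷ []) (# 5) (# 0) (# 1))
            (heavy-after (# 1 ∷ # 3 ∷ # 2 ∷ # 4 ∷ []) (# 0) (# 5) (# 1))
            (heavy-after (# 1 ∷ # 0 ∷ []) (# 1) (# 3) (# 0))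
            (heavy-after (# 0 ∷ # 3 ∷ # 2 ∷ # 4 ∷ []) (# 1) (# 5) (# 0))
            (heavy-after (# 0 ∷ # 1 ∷ []) (# 0) (# 5) (# 1))))
          (heavy-after (# 0 ∷ # 1 ∷ # 3 ∷ []) (# 1) (# 0) (# 2))
          (heavy-after (# 0 ∷ # 1 ∷ []) (# 3) (# 0) (# 1))
          (heavy-after (# 1 ∷ # 3 ∷ []) (# 1) (# 0) (# 2))
          (heavy-after (# 1 ∷ []) (# 3) (# 0) (# 1))))
        (heavy-after (# 1 ∷ # 2 ∷ # 0 ∷ # 3 ∷ []) (# 2) (# 0) (# 1))
        (heavy-after (# 1 ∷ []) (# 0) (# 3) (# 1))
        (heavy-after (# 0 ∷ # 2 ∷ # 1 ∷ # 3 ∷ []) (# 2) (# 1) (# 0))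
        (heavy-after (# 0 ∷ []) (# 1) (# 3) (# 0))))
      (split (# 0) (cases
        (split (# 5) (cases
          (heavy-after (# 0 ∷ # 1 ∷ # 3 ∷ # 4 ∷ # 2 ∷ # 0 ∷ []) (# 1) (# 2) (# 0))
          (heavy-after (# 0 ∷ # 1 ∷ # 3 ∷ # 4 ∷ []) (# 2) (# 0) (# 1))
          (heavy-after (# 0 ∷ # 1 ∷ # 0 ∷ []) (# 2) (# 1) (# 0))
          (heavy-after (# 0 ∷ # 1 ∷ # 3 ∷ # 2 ∷ []) (# 3) (# 4) (# 1))
          (heavy-after (# 0 ∷ # 1 ∷ []) (# 0) (# 3) (# 1))))
        (heavy-after (# 0 ∷ # 2 ∷ # 3 ∷ []) (# 1) (# 0) (# 2))
        (heavy-after (# 1 ∷ []) (# 0) (# 2) (# 1))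
        (heavy-after (# 0 ∷ # 2 ∷ # 1 ∷ []) (# 2) (# 3) (# 0))
        (heavy-after (# 0 ∷ []) (# 1) (# 2) (# 0))))
      (heavy-after (# 1 ∷ # 0 ∷ # 1 ∷ []) (# 0) (# 2) (# 1))
      (split (# 4) (cases
        (heavy-after (# 0 ∷ # 2 ∷ # 1 ∷ []) (# 0) (# 2) (# 1))
        (heavy-after (# 0 ∷ []) (# 2) (# 1) (# 0))
        (heavy-after (# 0 ∷ []) (# 2) (# 1) (# 0))
        (heavy-after (# 1 ∷ []) (# 2) (# 0) (# 1))
        (heavy-after (# 1 ∷ []) (# 2) (# 0) (# 1))))
      (heavy-after (# 0 ∷ # 1 ∷ []) (# 0) (# 2) (# 1))))
    (split (# 0) (cases
      (heavy-after (# 0 ∷ # 2 ∷ # 0 ∷ []) (# 1) (# 2) (# 0))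
      (heavy-after (# 1 ∷ []) (# 0) (# 2) (# 1))
      (heavy-after (# 1 ∷ []) (# 0) (# 2) (# 1))
      (heavy-after (# 0 ∷ []) (# 1) (# 2) (# 0))
      (heavy-after (# 0 ∷ []) (# 1) (# 2) (# 0))))
    (split (# 2) (cases
      (heavy-after (# 0 ∷ # 2 ∷ # 1 ∷ []) (# 0) (# 2) (# 1))
      (heavy-after (# 0 ∷ []) (# 2) (# 1) (# 0))
      (heavy-after (# 0 ∷ []) (# 2) (# 1) (# 0))
      (heavy-after (# 1 ∷ []) (# 2) (# 0) (# 1))
      (heavy-after (# 1 ∷ []) (# 2) (# 0) (# 1))))
    (split (# 2) (cases
      (heavy-after (# 0 ∷ # 2 ∷ []) (# 0) (# 1) (# 2))
      (heavy-after (# 0 ∷ []) (# 2) (# 1) (# 0))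
      (heavy-after (# 0 ∷ []) (# 2) (# 1) (# 0))
      (heavy-after (# 1 ∷ []) (# 2) (# 0) (# 1))
      (heavy-after (# 1 ∷ []) (# 2) (# 0) (# 1)))))

x7-certificate-valid : Valid [] x7-certificate
x7-certificate-valid = from-yes (valid? [] x7-certificate)

module _ {n : ℕ} (f : Fin 7 → Fin n) where

  InImage : Fin n → Set
  InImage w = ∃ λ a → f a ≡ w

  inImage? : ∀ w → Dec (InImage w)
  inImage? w = any? λ a → f a ≟ w

  -- With at least 8 vertices, some vertex lies outside the image of f:
  -- otherwise choosing preimages would inject Fin n into Fin 7.
  outside-vertex : 8 ≤ n → Injective _≡_ _≡_ f → ∃ λ w → ¬ InImage w
  outside-vertex 8≤n f-inj with all? inImage?
  ... | no ¬all = ¬∀⟶∃¬ n InImage inImage? ¬all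
  ... | yes all = ⊥-elim (<-irrefl refl (≤-trans 8≤n (injective⇒≤ preimage-inj)))
    where
    preimage-inj : Injective _≡_ _≡_ (λ w → proj₁ (all w))
    preimage-inj {w} {w′} e = trans (sym (proj₂ (all w))) (trans (cong f e) (proj₂ (all w′)))

  leave-image : ∀ {B : Arrows n} {x y} → Star (Adjacent B) x y → InImage x → ¬ InImage y →
                Σ (Fin 7) λ a → Σ (Fin n) λ v → ¬ InImage v × Adjacent B (f a) v
  leave-image ε x∈f y∉f = ⊥-elim (y∉f x∈f)
  leave-image (_◅_ {j = z} x~z z↝y) (a , refl) y∉f with inImage? z
  ... | yes z∈f = leave-image z↝y z∈f y∉f
  ... | no z∉f  = a , z , z∉f , x~z

theorem10 : (n : ℕ) → 8 ≤ n → (B : Arrows n) → IsGraph B → Connected B →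
            ContainsFull X₇ B → ¬ MutationFinite B
theorem10 n 8≤n B isGraph connected (f , f-inj , f-full) =
  let w , w∉f = outside-vertex f 8≤n f-inj
      a₀ , v , v∉f , v~fa₀ = leave-image f (connected (f (# 0)) w) (# 0 , refl) w∉f
      open Extension B isGraph f f-inj f-full v (λ a e → v∉f (a , e)) a₀ v~fa₀
  in unbounded⇒¬mutationFinite (sound [] [] x7-certificate x7-certificate-valid)
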